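{- The quotient algebra $\mathfrak{Fm}_s/\!\equiv_\vee$ is an $H^{\vee,\triangle}_3$-algebra with operations $|\alpha|\to|\beta|=|\alpha\to\beta|$, $|\alpha|\vee|\beta|=|\alpha\vee\beta|$, $\triangle|\alpha|=|\triangle\alpha|$ and $1=|\beta\to\beta|=\{\alpha\in\mathfrak{Fm}_s:\vdash_\vee\alpha\}$, where $|\delta|$ denotes the equivalence class of $\delta$.
   Context: $\mathfrak{Fm}_s$ is the absolutely free algebra of formulas over a countable set of propositional variables in signature $\{\to,\vee,\triangle\}$. The calculus $\mathcal{H}^3_{\vee,\triangle}$ has axiom schemas (Ax1) $\alpha\to(\beta\to\alpha)$; (Ax2) $(\alpha\to(\beta\to\gamma))\to((\alpha\to\beta)\to(\alpha\to\gamma))$; (Ax3) $((\alpha\to\beta)\to\gamma)\to(((\gamma\to\alpha)\to\gamma)\to\gamma)$; (Ax4) $\alpha\to(\alpha\vee\beta)$; (Ax5) $\beta\to(\alpha\vee\beta)$; (Ax6) $(\alpha\to\gamma)\to((\beta\to\gamma)\to((\alpha\vee\beta)\to\gamma))$; (Ax7) $\triangle\alpha\to\alpha$; (Ax8) $\triangle(\triangle\alpha\to\beta)\to(\triangle\alpha\to\triangle\beta)$; (Ax9) $((\beta\to\triangle\beta)\to(\alpha\to\triangle(\alpha\to\beta)))\to\triangle(\alpha\to\beta)$; (Ax10) $((\triangle\alpha\to\beta)\to\gamma)\to((\triangle\alpha\to\gamma)\to\gamma)$; rules: modus ponens and necessitation (from $\alpha$ infer $\triangle\alpha$). $\vdash_\vee$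 denotes derivability. $\alpha\equiv_\vee\beta$ iff $\vdash_\vee\alpha\to\beta$ and $\vdash_\vee\beta\to\alpha$; this is a congruence on $\mathfrak{Fm}_s$. An $H^{\vee,\triangle}_3$-algebra is an algebra $(A,\to,\vee,\triangle,1)$ such that: $(A,\vee,1)$ is a join-semilattice with top $1$; $x\to(x\vee y)=1$ and $(x\to y)\to((x\vee y)\to y)=1$; whenever the infimum $x\wedge y$ exists, $\triangle(x\wedge y)=\triangle x\wedge\triangle y$; $(A,\to,1)$ satisfies $x\to(y\to x)=1$, $(x\to(y\to z))\to((x\to y)\to(x\to z))=1$, ($x\to y=1=y\to x$ implies $x=y$), and $((x\to y)\to z)\to(((z\to x)\to z)\to z)=1$; and $\triangle x\to x=1$, $((y\to\triangle y)\to(x\to\triangle\triangle x))\to\triangle(x\to y)=\triangle x\to\triangle\triangle y$, $(\triangle x\to\triangle y)\to\triangle x=\triangle x$. -}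

module Defs where

open import Data.Nat using (ℕ)
open import Data.Product using (_×_)
open import Relation.Binary.Core using (Rel)
open import Relation.Binary.Structures using (IsEquivalence)
open import Level using (Level; _⊔_; suc)

infixr 6 _⇒_
infixl 7 _∨_

data Fm : Set where
  var : ℕ → Fm
  _⇒_ : Fm → Fm → Fm
  _∨_ : Fm → Fm → Fm
  △   : Fm → Fm

data ⊢_ : Fm → Set where
  ax1  : ∀ α β → ⊢ (α ⇒ (β ⇒ α))
  ax2  : ∀ α β γ → ⊢ ((α ⇒ (β ⇒ γ)) ⇒ ((α ⇒ β) ⇒ (α ⇒ γ)))
  ax3  : ∀ α β γ → ⊢ (((α ⇒ β) ⇒ γ) ⇒ (((γ ⇒ α) ⇒ γ) ⇒ γ))
  ax4  : ∀ α β → ⊢ (α ⇒ (α ∨ β))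
  ax5  : ∀ α β → ⊢ (β ⇒ (α ∨ β))
  ax6  : ∀ α β γ → ⊢ ((α ⇒ γ) ⇒ ((β ⇒ γ) ⇒ ((α ∨ β) ⇒ γ)))
  ax7  : ∀ α → ⊢ (△ α ⇒ α)
  ax8  : ∀ α β → ⊢ (△ (△ α ⇒ β) ⇒ (△ α ⇒ △ β))
  ax9  : ∀ α β → ⊢ (((β ⇒ △ β) ⇒ (α ⇒ △ (α ⇒ β))) ⇒ △ (α ⇒ β))
  ax10 : ∀ α β γ → ⊢ (((△ α ⇒ β) ⇒ γ) ⇒ ((△ α ⇒ γ) ⇒ γ))
  mp   : ∀ {α β} → ⊢ α → ⊢ (α ⇒ β) → ⊢ β
  nec  : ∀ {α} → ⊢ α → ⊢ △ α

_≡∨_ : Fm → Fm → Set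
α ≡∨ β = (⊢ (α ⇒ β)) × (⊢ (β ⇒ α))

-- H^{∨,△}_3-algebras, presented on a setoid (A, ≈) since Agda has no quotient
-- types; the operations are required to be congruences for ≈, which is what
-- makes them well-defined operations on the quotient A/≈.
record IsH3Algebra {a ℓ : Level} (A : Set a) (_≈_ : Rel A ℓ)
    (_↦_ : A → A → A) (_⊔'_ : A → A → A) (Δ : A → A) (one : A) : Set (a ⊔ suc ℓ) where
  field
    isEquivalence : IsEquivalence _≈_
    ↦-cong : ∀ {x x' y y'} → x ≈ x' → y ≈ y' → (x ↦ y) ≈ (x' ↦ y')
    ⊔-cong : ∀ {x x' y y'} → x ≈ x' → y ≈ y' → (x ⊔' y) ≈ (x' ⊔' y')
    Δ-cong : ∀ {x x'} → x ≈ x' → Δ x ≈ Δ x'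
    ⊔-assoc : ∀ x y z → ((x ⊔' y) ⊔' z) ≈ (x ⊔' (y ⊔' z))
    ⊔-comm  : ∀ x y → (x ⊔' y) ≈ (y ⊔' x)
    ⊔-idem  : ∀ x → (x ⊔' x) ≈ x
    ⊔-top   : ∀ x → (x ⊔' one) ≈ one
    ⊔-ax1 : ∀ x y → (x ↦ (x ⊔' y)) ≈ one
    ⊔-ax2 : ∀ x y → ((x ↦ y) ↦ ((x ⊔' y) ↦ y)) ≈ one
    -- whenever the infimum m = x ∧ y exists (w.r.t. the semilattice order
    -- u ≤ v iff u ∨ v = v), △m is the infimum of △x and △y
    Δ-inf : ∀ x y m →
      (m ⊔' x) ≈ x → (m ⊔' y) ≈ y → (∀ z → (z ⊔' x) ≈ x → (z ⊔' y) ≈ y → (z ⊔' m) ≈ m) →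
      ((Δ m ⊔' Δ x) ≈ Δ x) × ((Δ m ⊔' Δ y) ≈ Δ y) ×
      (∀ z → (z ⊔' Δ x) ≈ Δ x → (z ⊔' Δ y) ≈ Δ y → (z ⊔' Δ m) ≈ Δ m)
    -- (A, →, 1) is a Hilbert algebra satisfying the extra 3-valued axiom
    H1 : ∀ x y → (x ↦ (y ↦ x)) ≈ one
    H2 : ∀ x y z → ((x ↦ (y ↦ z)) ↦ ((x ↦ y) ↦ (x ↦ z))) ≈ one
    H3 : ∀ x y → (x ↦ y) ≈ one → (y ↦ x) ≈ one → x ≈ y
    H4 : ∀ x y z → (((x ↦ y) ↦ z) ↦ (((z ↦ x) ↦ z) ↦ z)) ≈ one
    Δ1 : ∀ x → (Δ x ↦ x) ≈ one
    Δ2 : ∀ x y → (((y ↦ Δ y) ↦ (x ↦ Δ (Δ x))) ↦ Δ (x ↦ y)) ≈ (Δ x ↦ Δ (Δ y))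
    Δ3 : ∀ x y → ((Δ x ↦ Δ y) ↦ Δ x) ≈ Δ x

-- Every quotient law is witnessed by a derivation in the calculus, built via
-- a deduction theorem for Hilbert-style proofs from hypotheses.  The only
-- non-routine law is that △ preserves existing infima: a lower bound z of △x
-- and △y yields the lower bound z* = (z ⇒ △z) ⇒ z of x and y (by Ax10), hence
-- z* ≤ x ∧ y, and z ≤ △z* (by Ax9) then gives z ≤ △(x ∧ y).
module Submission where

open import Defs
open import Data.List using (List; []; _∷_)
open import Data.List.Membership.Propositional using (_∈_)
open import Data.List.Relation.Unary.Any using (here; there)
open import Data.Product using (_×_; _,_; proj₁; proj₂)
open import Function.Bundles using (_⇔_; mk⇔)
open import Relation.Binary.PropositionalEquality using (refl)

infix 3 _⊩_
infixl 5 _·_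

data _⊩_ (Γ : List Fm) : Fm → Set where
  hyp : ∀ {α} → α ∈ Γ → Γ ⊩ α
  thm : ∀ {α} → ⊢ α → Γ ⊩ α
  _·_ : ∀ {α β} → Γ ⊩ (α ⇒ β) → Γ ⊩ α → Γ ⊩ β

#0 : ∀ {Γ α} → (α ∷ Γ) ⊩ α
#0 = hyp (here refl)

#1 : ∀ {Γ α β} → (β ∷ α ∷ Γ) ⊩ α
#1 = hyp (there (here refl))

#2 : ∀ {Γ α β γ} → (γ ∷ β ∷ α ∷ Γ) ⊩ α
#2 = hyp (there (there (here refl)))

#3 : ∀ {Γ α β γ δ} → (δ ∷ γ ∷ β ∷ α ∷ Γ) ⊩ α
#3 = hyp (there (there (there (here refl))))

⇒-refl : ∀ α → ⊢ (α ⇒ α)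
⇒-refl α = mp (ax1 α α) (mp (ax1 α (α ⇒ α)) (ax2 α (α ⇒ α) α))

deduction : ∀ {Γ α β} → (α ∷ Γ) ⊩ β → Γ ⊩ (α ⇒ β)
deduction (hyp (here refl)) = thm (⇒-refl _)
deduction (hyp (there p))   = thm (ax1 _ _) · hyp p
deduction (thm t)           = thm (ax1 _ _) · thm t
deduction (f · a)           = thm (ax2 _ _ _) · deduction f · deduction a

closed : ∀ {α} → [] ⊩ α → ⊢ α
closed (hyp ())
closed (thm t) = t
closed (f · a) = mp (closed a) (closed f)

⇒-trans : ∀ {α β γ} → ⊢ (α ⇒ β) → ⊢ (β ⇒ γ) → ⊢ (α ⇒ γ)
⇒-trans f g = closed (deduction (thm g · (thm f · #0)))

⇒-mono : ∀ {α α' β β'} → ⊢ (α' ⇒ α) → ⊢ (β ⇒ β') → ⊢ ((α ⇒ β) ⇒ (α' ⇒ β'))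
⇒-mono f g = closed (deduction (deduction (thm g · (#1 · (thm f · #0)))))

∨-elim : ∀ {α β γ} → ⊢ (α ⇒ γ) → ⊢ (β ⇒ γ) → ⊢ ((α ∨ β) ⇒ γ)
∨-elim f g = mp g (mp f (ax6 _ _ _))

∨-mono : ∀ {α α' β β'} → ⊢ (α ⇒ α') → ⊢ (β ⇒ β') → ⊢ ((α ∨ β) ⇒ (α' ∨ β'))
∨-mono f g = ∨-elim (⇒-trans f (ax4 _ _)) (⇒-trans g (ax5 _ _))

△-mono : ∀ {α β} → ⊢ (α ⇒ β) → ⊢ (△ α ⇒ △ β)
△-mono {α} {β} f = mp (nec (⇒-trans (ax7 α) f)) (ax8 α β)

△⇒△△ : ∀ α → ⊢ (△ α ⇒ △ (△ α))
△⇒△△ α = mp (nec (⇒-refl (△ α))) (ax8 α (△ α))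

one : Fm
one = var 0 ⇒ var 0

theorems-≡∨ : ∀ {α β} → ⊢ α → ⊢ β → α ≡∨ β
theorems-≡∨ {α} {β} s t = mp t (ax1 β α) , mp s (ax1 α β)

⊢⇒≡∨one : ∀ {α} → ⊢ α → α ≡∨ one
⊢⇒≡∨one t = theorems-≡∨ t (⇒-refl (var 0))

≡∨one⇒⊢ : ∀ {α} → α ≡∨ one → ⊢ α
≡∨one⇒⊢ e = mp (⇒-refl (var 0)) (proj₂ e)

_⊑_ : Fm → Fm → Set
α ⊑ β = (α ∨ β) ≡∨ β

⊑⇒⊢⇒ : ∀ {α β} → α ⊑ β → ⊢ (α ⇒ β)
⊑⇒⊢⇒ {α} {β} e = ⇒-trans (ax4 α β) (proj₁ e)

⊢⇒⇒⊑ : ∀ {α β} → ⊢ (α ⇒ β) → α ⊑ β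
⊢⇒⇒⊑ {α} {β} f = ∨-elim f (⇒-refl β) , ax5 α β

∨-assoc : ∀ α β γ → ((α ∨ β) ∨ γ) ≡∨ (α ∨ (β ∨ γ))
∨-assoc α β γ =
    ∨-elim (∨-elim (ax4 _ _) (⇒-trans (ax4 _ _) (ax5 _ _))) (⇒-trans (ax5 _ _) (ax5 _ _))
  , ∨-elim (⇒-trans (ax4 _ _) (ax4 _ _)) (∨-elim (⇒-trans (ax5 _ _) (ax4 _ _)) (ax5 _ _))

∨-comm : ∀ α β → (α ∨ β) ≡∨ (β ∨ α)
∨-comm α β = ∨-elim (ax5 _ _) (ax4 _ _) , ∨-elim (ax5 _ _) (ax4 _ _)

∨-idem : ∀ α → (α ∨ α) ≡∨ α
∨-idem α = ∨-elim (⇒-refl α) (⇒-refl α) , ax4 α α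

∨-one : ∀ α → (α ∨ one) ≡∨ one
∨-one α = ⊢⇒⇒⊑ (mp (⇒-refl (var 0)) (ax1 one α))

⇒-∨-elim : ∀ α β → ⊢ ((α ⇒ β) ⇒ ((α ∨ β) ⇒ β))
⇒-∨-elim α β = closed (deduction (thm (ax6 α β β) · #0 · thm (⇒-refl β)))

△-lower-bound : ∀ {z α} → ⊢ (z ⇒ △ α) → ⊢ (((z ⇒ △ z) ⇒ z) ⇒ α)
△-lower-bound {z} {α} f = closed (deduction (thm (ax10 α (△ z) α)
  · deduction (thm (ax7 α) · (thm f · (#1 · deduction (#1 · (thm f · #0)))))
  · thm (ax7 α)))

⇒△-lower-bound : ∀ z → ⊢ (z ⇒ △ ((z ⇒ △ z) ⇒ z))
⇒△-lower-bound z = closed (deduction (thm (ax9 (z ⇒ △ z) z)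
  · deduction (deduction (thm (△-mono (ax1 z (z ⇒ △ z))) · (#0 · #2)))))

△-glb : ∀ α β μ → μ ⊑ α → μ ⊑ β → (∀ z → z ⊑ α → z ⊑ β → z ⊑ μ) →
  (△ μ ⊑ △ α) × (△ μ ⊑ △ β) × (∀ z → z ⊑ △ α → z ⊑ △ β → z ⊑ △ μ)
△-glb α β μ μ⊑α μ⊑β glb =
    ⊢⇒⇒⊑ (△-mono (⊑⇒⊢⇒ μ⊑α))
  , ⊢⇒⇒⊑ (△-mono (⊑⇒⊢⇒ μ⊑β))
  , λ z z⊑△α z⊑△β → ⊢⇒⇒⊑ (⇒-trans (⇒△-lower-bound z) (△-mono (⊑⇒⊢⇒
      (glb _ (⊢⇒⇒⊑ (△-lower-bound (⊑⇒⊢⇒ z⊑△α))) (⊢⇒⇒⊑ (△-lower-bound (⊑⇒⊢⇒ z⊑△β)))))))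

△-ax9-premise⇒△⇒△△ : ∀ α β →
  ⊢ ((((β ⇒ △ β) ⇒ (α ⇒ △ (△ α))) ⇒ △ (α ⇒ β)) ⇒ (△ α ⇒ △ (△ β)))
△-ax9-premise⇒△⇒△△ α β = closed (deduction (deduction (thm (△⇒△△ β)
  · (thm (ax8 α β) · (thm (△-mono △-antecedent) · (#1 · ax9-subpremise)) · #0))))
  where
  ax9-subpremise : ∀ {Γ} → (△ α ∷ Γ) ⊩ ((β ⇒ △ β) ⇒ (α ⇒ △ (△ α)))
  ax9-subpremise = deduction (deduction (thm (△⇒△△ α) · #2))

  △-antecedent : ⊢ ((α ⇒ β) ⇒ (△ α ⇒ β))
  △-antecedent = closed (deduction (deduction (#1 · (thm (ax7 α) · #0))))

△⇒△△⇒△-ax9-premise : ∀ α β →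
  ⊢ ((△ α ⇒ △ (△ β)) ⇒ (((β ⇒ △ β) ⇒ (α ⇒ △ (△ α))) ⇒ △ (α ⇒ β)))
△⇒△△⇒△-ax9-premise α β = closed (deduction (deduction (thm (ax9 α β) · deduction (deduction
  (thm (△-mono (ax1 β α)) · (thm (ax7 (△ β)) · (#3 · (thm (ax7 (△ α)) · (#2 · #1 · #0)))))))))

△-absorb : ∀ α β → ((△ α ⇒ △ β) ⇒ △ α) ≡∨ △ α
△-absorb α β =
    closed (deduction (thm (ax10 α (△ β) (△ α)) · #0 · thm (⇒-refl (△ α))))
  , ax1 (△ α) (△ α ⇒ △ β)

lindenbaumAlgebra : IsH3Algebra Fm _≡∨_ _⇒_ _∨_ △ one
lindenbaumAlgebra = record
  { isEquivalence = record
      { refl  = ⇒-refl _ , ⇒-refl _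
      ; sym   = λ (f , g) → g , f
      ; trans = λ (f , g) (f' , g') → ⇒-trans f f' , ⇒-trans g' g }
  ; ↦-cong  = λ (f , g) (f' , g') → ⇒-mono g f' , ⇒-mono f g'
  ; ⊔-cong  = λ (f , g) (f' , g') → ∨-mono f f' , ∨-mono g g'
  ; Δ-cong  = λ (f , g) → △-mono f , △-mono g
  ; ⊔-assoc = ∨-assoc
  ; ⊔-comm  = ∨-comm
  ; ⊔-idem  = ∨-idem
  ; ⊔-top   = ∨-one
  ; ⊔-ax1   = λ α β → ⊢⇒≡∨one (ax4 α β)
  ; ⊔-ax2   = λ α β → ⊢⇒≡∨one (⇒-∨-elim α β)
  ; Δ-inf   = △-glb
  ; H1      = λ α β → ⊢⇒≡∨one (ax1 α β)
  ; H2      = λ α β γ → ⊢⇒≡∨one (ax2 α β γ)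
  ; H3      = λ α β e e' → ≡∨one⇒⊢ e , ≡∨one⇒⊢ e'
  ; H4      = λ α β γ → ⊢⇒≡∨one (ax3 α β γ)
  ; Δ1      = λ α → ⊢⇒≡∨one (ax7 α)
  ; Δ2      = λ α β → △-ax9-premise⇒△⇒△△ α β , △⇒△△⇒△-ax9-premise α β
  ; Δ3      = △-absorb
  }

mainTheorem12 : IsH3Algebra Fm _≡∨_ _⇒_ _∨_ △ (var 0 ⇒ var 0)
    × (∀ β → (var 0 ⇒ var 0) ≡∨ (β ⇒ β))
    × (∀ α → (α ≡∨ (var 0 ⇒ var 0)) ⇔ (⊢ α))
mainTheorem12 =
    lindenbaumAlgebra
  , (λ β → theorems-≡∨ (⇒-refl (var 0)) (⇒-refl β))
  , (λ α → mk⇔ ≡∨one⇒⊢ ⊢⇒≡∨one)
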